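{- Let $m,n,s,t$ be positive integers. If a shiftable integer Heffter array $H(m,n;s,t)$ exists, then $s$ and $t$ are both even and at least $4$, and $ms\equiv 0 \pmod 4$.
   Context: An integer Heffter array $H(m,n;s,t)$ is an $m\times n$ array, each cell empty or filled with an integer, with exactly $s$ filled cells in each row and exactly $t$ filled cells in each column, such that the filled entries form a half-set of $\{\pm k : k=1,\dots,ms\}$ (i.e., for each $k=1,\dots,ms$ exactly one of $k,-k$ appears, and it appears exactly once), and the entries of each row and of each column sum to $0$ over the integers. It is shiftable if each row and each column contains the same number of positive entries as negative entries. -}

module Defs where

open import Data.Nat using (ℕ; zero; suc; _+_; _*_; _≤_)
open import Data.Nat.Properties using (_≟_)
open import Data.Integer as ℤ using (ℤ; +_; -[1+_]; ∣_∣)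
open import Data.Fin using (Fin; zero; suc)
open import Data.Bool using (if_then_else_)
open import Data.Maybe using (Maybe; just; nothing)
open import Data.Product using (_×_)
open import Relation.Nullary.Decidable using (⌊_⌋)
open import Relation.Binary.PropositionalEquality using (_≡_)

Σℕ : ∀ {k} → (Fin k → ℕ) → ℕ
Σℕ {zero}  f = 0
Σℕ {suc k} f = f zero + Σℕ (λ i → f (suc i))

Σℤ : ∀ {k} → (Fin k → ℤ) → ℤ
Σℤ {zero}  f = + 0
Σℤ {suc k} f = f zero ℤ.+ Σℤ (λ i → f (suc i))

-- a partially filled m × n array of integers (nothing = empty cell)
Array : ℕ → ℕ → Set
Array m n = Fin m → Fin n → Maybe ℤ

val : Maybe ℤ → ℤ
val (just x) = x
val nothing  = + 0

filled : Maybe ℤ → ℕ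
filled (just _) = 1
filled nothing  = 0

positive : Maybe ℤ → ℕ
positive (just (+ suc _)) = 1
positive _                = 0

negative : Maybe ℤ → ℕ
negative (just -[1+ _ ]) = 1
negative _               = 0

hasAbs : ℕ → Maybe ℤ → ℕ
hasAbs k (just x) = if ⌊ ∣ x ∣ ≟ k ⌋ then 1 else 0
hasAbs k nothing  = 0

record IsHeffter (m n s t : ℕ) (A : Array m n) : Set where
  field
    rowFilled : ∀ i → Σℕ (λ j → filled (A i j)) ≡ s
    colFilled : ∀ j → Σℕ (λ i → filled (A i j)) ≡ t
    entryRange : ∀ i j x → A i j ≡ just x → 1 ≤ ∣ x ∣ × ∣ x ∣ ≤ m * s
    halfSet : ∀ k → 1 ≤ k → k ≤ m * s →
      Σℕ (λ i → Σℕ (λ j → hasAbs k (A i j))) ≡ 1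
    rowSum : ∀ i → Σℤ (λ j → val (A i j)) ≡ + 0
    colSum : ∀ j → Σℤ (λ i → val (A i j)) ≡ + 0

record IsShiftable {m n : ℕ} (A : Array m n) : Set where
  field
    rowBalanced : ∀ i → Σℕ (λ j → positive (A i j)) ≡ Σℕ (λ j → negative (A i j))
    colBalanced : ∀ j → Σℕ (λ i → positive (A i j)) ≡ Σℕ (λ i → negative (A i j))

module Submission where

-- Every filled cell is non-zero, so a line (row or column) with c filled
-- cells has c = #positive + #negative; shiftability makes these two counts
-- equal, hence c is even.  If c = 2, the line consists of one entry a > 0
-- and one entry -b < 0 with a - b = 0, so the absolute value a occurs twice,
-- contradicting the half-set condition; hence c ≥ 4.
--
-- For the divisibility, write N = ms.  Summing the absolute values of all
-- entries gives 1 + ⋯ + N (half-set condition), while each zero row sum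
-- says that its positive part P_i equals its negative part; hence
-- N(N+1)/2 = 2 ΣP_i, i.e. 4 ∣ N(N+1).  As s is even, N is even, and then
-- 4 ∣ N² forces 4 ∣ N.

open import Defs
open import Data.Nat using (ℕ; zero; suc; _+_; _*_; _≤_; _<_; z≤n; s≤s)
open import Data.Nat.Properties
open import Data.Nat.Divisibility using (_∣_; divides; ∣m+n∣m⇒∣n; ∣n⇒∣m*n)
open import Data.Nat.Tactic.RingSolver using (solve-∀)
open import Data.Integer as ℤ using (ℤ; +_; -[1+_]; ∣_∣)
import Data.Integer.Properties as ℤP
import Data.Integer.Tactic.RingSolver as ℤSolver
open import Data.Fin using (Fin; zero; suc; fromℕ<)
open import Data.Maybe using (Maybe; just; nothing)
open import Data.Product using (Σ-syntax; _×_; _,_; proj₁; proj₂)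
open import Data.Empty using (⊥-elim)
open import Data.Bool using (if_then_else_)
open import Relation.Nullary using (yes; no)
open import Relation.Nullary.Decidable using (⌊_⌋)
open import Relation.Binary.PropositionalEquality

Σ-cong : ∀ {k} {f g : Fin k → ℕ} → (∀ j → f j ≡ g j) → Σℕ f ≡ Σℕ g
Σ-cong {zero}  e = refl
Σ-cong {suc k} e = cong₂ _+_ (e zero) (Σ-cong (λ i → e (suc i)))

Σ-+ : ∀ {k} (f g : Fin k → ℕ) → Σℕ (λ j → f j + g j) ≡ Σℕ f + Σℕ g
Σ-+ {zero}  f g = refl
Σ-+ {suc k} f g =
  trans (cong (λ z → f zero + g zero + z) (Σ-+ (λ i → f (suc i)) (λ i → g (suc i))))
        (+-exchange (f zero) (g zero) _ _)
  where
  +-exchange : ∀ a b c d → a + b + (c + d) ≡ a + c + (b + d)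
  +-exchange = solve-∀

Σ-*ˡ : ∀ {k} c (f : Fin k → ℕ) → Σℕ (λ j → c * f j) ≡ c * Σℕ f
Σ-*ˡ {zero}  c f = sym (*-zeroʳ c)
Σ-*ˡ {suc k} c f =
  trans (cong (λ z → c * f zero + z) (Σ-*ˡ c (λ i → f (suc i)))) (sym (*-distribˡ-+ c (f zero) _))

Σ-mono : ∀ {k} {f g : Fin k → ℕ} → (∀ j → f j ≤ g j) → Σℕ f ≤ Σℕ g
Σ-mono {zero}  h = z≤n
Σ-mono {suc k} h = +-mono-≤ (h zero) (Σ-mono (λ i → h (suc i)))

Σ-term : ∀ {k} (f : Fin k → ℕ) j → f j ≤ Σℕ f
Σ-term f zero    = m≤m+n _ _
Σ-term f (suc j) = ≤-trans (Σ-term (λ i → f (suc i)) j) (m≤n+m _ (f zero))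

Σ-two : ∀ {k} (f : Fin k → ℕ) {i j} → i ≢ j → 1 ≤ f i → 1 ≤ f j → 2 ≤ Σℕ f
Σ-two f {zero}  {zero}  i≢j _  _  = ⊥-elim (i≢j refl)
Σ-two f {zero}  {suc j} _   fi fj = +-mono-≤ fi (≤-trans fj (Σ-term (λ i → f (suc i)) j))
Σ-two f {suc i} {zero}  _   fi fj = +-mono-≤ fj (≤-trans fi (Σ-term (λ i → f (suc i)) i))
Σ-two f {suc i} {suc j} i≢j fi fj =
  ≤-trans (Σ-two (λ i → f (suc i)) (λ e → i≢j (cong suc e)) fi fj) (m≤n+m _ (f zero))

Σ-vanish : ∀ {k} {f : Fin k → ℕ} → (∀ j → f j ≡ 0) → Σℕ f ≡ 0
Σ-vanish {zero}  z = refl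
Σ-vanish {suc k} z = cong₂ _+_ (z zero) (Σ-vanish (λ i → z (suc i)))

Σ≡0⇒vanish : ∀ {k} (f : Fin k → ℕ) → Σℕ f ≡ 0 → ∀ j → f j ≡ 0
Σ≡0⇒vanish f e zero    = m+n≡0⇒m≡0 (f zero) e
Σ≡0⇒vanish f e (suc j) = Σ≡0⇒vanish (λ i → f (suc i)) (m+n≡0⇒n≡0 (f zero) e) j

Σ-single : ∀ {k} (g w : Fin k → ℕ) → Σℕ g ≡ 1 → (∀ i → g i ≡ 0 → w i ≡ 0) →
  Σ[ j ∈ Fin k ] (g j ≡ 1 × Σℕ w ≡ w j)
Σ-single {zero} g w ()
Σ-single {suc k} g w Σg≡1 w-supp with g zero in g₀
... | zero with Σ-single (λ i → g (suc i)) (λ i → w (suc i)) Σg≡1 (λ i → w-supp (suc i))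
...   | j , gj≡1 , Σw′≡wj = suc j , gj≡1 , cong₂ _+_ (w-supp zero g₀) Σw′≡wj
Σ-single {suc k} g w Σg≡1 w-supp | suc zero =
  zero , g₀ , trans (cong (λ z → w zero + z) (Σ-vanish rest≡0)) (+-identityʳ _)
  where
  rest≡0 : ∀ i → w (suc i) ≡ 0
  rest≡0 i = w-supp (suc i) (Σ≡0⇒vanish (λ i → g (suc i)) (suc-injective Σg≡1) i)
Σ-single {suc k} g w Σg≡1 w-supp | suc (suc _) = ⊥-elim (1+n≢0 (suc-injective Σg≡1))

sumTo : ℕ → (ℕ → ℕ) → ℕ
sumTo zero    g = 0
sumTo (suc n) g = sumTo n g + g (suc n)

sumTo-cong : ∀ n {g h : ℕ → ℕ} → (∀ k → 1 ≤ k → k ≤ n → g k ≡ h k) → sumTo n g ≡ sumTo n h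
sumTo-cong zero    e = refl
sumTo-cong (suc n) e =
  cong₂ _+_ (sumTo-cong n (λ k 1≤k k≤n → e k 1≤k (m≤n⇒m≤1+n k≤n))) (e (suc n) (s≤s z≤n) ≤-refl)

sumTo-vanish : ∀ n {g : ℕ → ℕ} → (∀ k → g k ≡ 0) → sumTo n g ≡ 0
sumTo-vanish zero    z = refl
sumTo-vanish (suc n) z = cong₂ _+_ (sumTo-vanish n z) (z (suc n))

Σ-sumTo : ∀ {k} n (g : Fin k → ℕ → ℕ) →
  Σℕ (λ i → sumTo n (g i)) ≡ sumTo n (λ x → Σℕ (λ i → g i x))
Σ-sumTo zero    g = Σ-vanish {f = λ i → sumTo zero (g i)} (λ _ → refl)
Σ-sumTo (suc n) g =
  trans (Σ-+ (λ i → sumTo n (g i)) (λ i → g i (suc n)))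
        (cong (_+ Σℕ (λ i → g i (suc n))) (Σ-sumTo n g))

gauss : ∀ n → 2 * sumTo n (λ k → k) ≡ n * suc n
gauss zero    = refl
gauss (suc n) =
  trans (*-distribˡ-+ 2 (sumTo n (λ k → k)) (suc n))
        (trans (cong (_+ 2 * suc n) (gauss n)) (step n))
  where
  step : ∀ n → n * suc n + 2 * suc n ≡ suc n * suc (suc n)
  step = solve-∀

isValue : ℕ → ℕ → ℕ
isValue a k = if ⌊ a ≟ k ⌋ then 1 else 0

x+n*0≡x : ∀ x n → x + n * 0 ≡ x
x+n*0≡x x n = trans (cong (λ z → x + z) (*-zeroʳ n)) (+-identityʳ x)

sumTo-isValue-below : ∀ n a → n < a → sumTo n (λ k → k * isValue a k) ≡ 0
sumTo-isValue-below zero    a _   = refl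
sumTo-isValue-below (suc n) a n<a with a ≟ suc n
... | yes a≡n+1 = ⊥-elim (<-irrefl (sym a≡n+1) n<a)
... | no  _     =
  trans (x+n*0≡x _ n) (sumTo-isValue-below n a (<-trans (n<1+n n) n<a))

sumTo-isValue : ∀ n a → 1 ≤ a → a ≤ n → sumTo n (λ k → k * isValue a k) ≡ a
sumTo-isValue zero    a 1≤a a≤0 = ⊥-elim (<-irrefl refl (≤-trans 1≤a a≤0))
sumTo-isValue (suc n) a 1≤a a≤n+1 with a ≟ suc n
... | yes refl =
  trans (cong (_+ suc n * 1) (sumTo-isValue-below n (suc n) (n<1+n n))) (*-identityʳ (suc n))
... | no a≢n+1 =
  trans (x+n*0≡x _ n) (sumTo-isValue n a 1≤a (≤-pred (≤∧≢⇒< a≤n+1 a≢n+1)))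

-- an even n with 4 ∣ n(n+1) is divisible by 4, since 4 ∣ n²
4∣n[n+1]⇒4∣n : ∀ n → 2 ∣ n → 4 ∣ n * suc n → 4 ∣ n
4∣n[n+1]⇒4∣n n (divides q refl) 4∣n[n+1] =
  ∣m+n∣m⇒∣n (subst (4 ∣_) (square+self (q * 2)) 4∣n[n+1]) (divides (q * q) (square q))
  where
  square+self : ∀ n → n * suc n ≡ n * n + n
  square+self = solve-∀
  square : ∀ q → q * 2 * (q * 2) ≡ q * q * 4
  square = solve-∀

posPart : Maybe ℤ → ℕ
posPart (just (+ a)) = a
posPart _            = 0

negPart : Maybe ℤ → ℕ
negPart (just -[1+ b ]) = suc b
negPart _               = 0

parts-abs : ∀ c → posPart c + negPart c ≡ ∣ val c ∣
parts-abs nothing         = refl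
parts-abs (just (+ a))    = +-identityʳ a
parts-abs (just -[1+ b ]) = refl

parts-val : ∀ c → val c ℤ.+ + negPart c ≡ + posPart c
parts-val nothing         = refl
parts-val (just (+ a))    = ℤP.+-identityʳ (+ a)
parts-val (just -[1+ b ]) = ℤP.+-inverseˡ (+ suc b)

Σ-parts-val : ∀ {k} (f : Fin k → Maybe ℤ) →
  Σℤ (λ j → val (f j)) ℤ.+ + Σℕ (λ j → negPart (f j)) ≡ + Σℕ (λ j → posPart (f j))
Σ-parts-val {zero}  f = refl
Σ-parts-val {suc k} f = begin
    (val c ℤ.+ V) ℤ.+ + (negPart c + Neg)
  ≡⟨ cong (λ z → (val c ℤ.+ V) ℤ.+ z) (ℤP.pos-+ (negPart c) Neg) ⟩
    (val c ℤ.+ V) ℤ.+ (+ negPart c ℤ.+ + Neg)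
  ≡⟨ exchange (val c) V (+ negPart c) (+ Neg) ⟩
    (val c ℤ.+ + negPart c) ℤ.+ (V ℤ.+ + Neg)
  ≡⟨ cong₂ ℤ._+_ (parts-val c) (Σ-parts-val (λ i → f (suc i))) ⟩
    + posPart c ℤ.+ + Σℕ (λ i → posPart (f (suc i)))
  ≡⟨ sym (ℤP.pos-+ (posPart c) _) ⟩
    + (posPart c + Σℕ (λ i → posPart (f (suc i))))
  ∎
  where
  open ≡-Reasoning
  c : Maybe ℤ
  c = f zero
  V : ℤ
  V = Σℤ (λ i → val (f (suc i)))
  Neg : ℕ
  Neg = Σℕ (λ i → negPart (f (suc i)))
  exchange : ∀ (a b c d : ℤ) → (a ℤ.+ b) ℤ.+ (c ℤ.+ d) ≡ (a ℤ.+ c) ℤ.+ (b ℤ.+ d)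
  exchange = ℤSolver.solve-∀

zeroSum⇒parts≡ : ∀ {k} (f : Fin k → Maybe ℤ) → Σℤ (λ j → val (f j)) ≡ + 0 →
  Σℕ (λ j → posPart (f j)) ≡ Σℕ (λ j → negPart (f j))
zeroSum⇒parts≡ f sum≡0 =
  sym (ℤP.+-injective (trans (cong (λ z → z ℤ.+ + Σℕ (λ j → negPart (f j))) (sym sum≡0)) (Σ-parts-val f)))

nonzero⇒signs : ∀ c → (∀ x → c ≡ just x → 1 ≤ ∣ x ∣) → positive c + negative c ≡ filled c
nonzero⇒signs nothing           _       = refl
nonzero⇒signs (just (+ zero))   nonzero with nonzero (+ zero) refl
... | ()
nonzero⇒signs (just (+ suc a))  _       = refl
nonzero⇒signs (just -[1+ b ])   _       = refl

notPositive⇒posPart≡0 : ∀ c → positive c ≡ 0 → posPart c ≡ 0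
notPositive⇒posPart≡0 nothing         _ = refl
notPositive⇒posPart≡0 (just (+ zero)) _ = refl
notPositive⇒posPart≡0 (just -[1+ b ]) _ = refl

notNegative⇒negPart≡0 : ∀ c → negative c ≡ 0 → negPart c ≡ 0
notNegative⇒negPart≡0 nothing         _ = refl
notNegative⇒negPart≡0 (just (+ a))    _ = refl

positive⇒notNegative : ∀ c → positive c ≡ 1 → negative c ≡ 0
positive⇒notNegative (just (+ suc a)) _ = refl

hasAbs-self : ∀ x → hasAbs ∣ x ∣ (just x) ≡ 1
hasAbs-self x rewrite ≟-diag (refl {x = ∣ x ∣}) = refl

positive⇒hasAbs : ∀ c → positive c ≡ 1 → hasAbs (posPart c) c ≡ 1
positive⇒hasAbs (just (+ suc a)) _ = hasAbs-self (+ suc a)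

negative⇒hasAbs : ∀ c → negative c ≡ 1 → hasAbs (negPart c) c ≡ 1
negative⇒hasAbs (just -[1+ b ]) _ = hasAbs-self -[1+ b ]

hasAbs⇒inRange : ∀ N K c → (∀ x → c ≡ just x → 1 ≤ ∣ x ∣ × ∣ x ∣ ≤ N) →
  1 ≤ hasAbs K c → 1 ≤ K × K ≤ N
hasAbs⇒inRange N K nothing  _   ()
hasAbs⇒inRange N K (just x) rng hit with ∣ x ∣ ≟ K
... | yes refl = rng x refl
... | no  _    with hit
...   | ()

module Line {k : ℕ} (N c : ℕ) (f : Fin k → Maybe ℤ)
  (range    : ∀ j x → f j ≡ just x → 1 ≤ ∣ x ∣ × ∣ x ∣ ≤ N)
  (count    : Σℕ (λ j → filled (f j)) ≡ c)
  (balanced : Σℕ (λ j → positive (f j)) ≡ Σℕ (λ j → negative (f j)))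
  (zeroSum  : Σℤ (λ j → val (f j)) ≡ + 0) where

  #pos : ℕ
  #pos = Σℕ (λ j → positive (f j))

  c≡#pos+#pos : c ≡ #pos + #pos
  c≡#pos+#pos = begin
      c
    ≡⟨ sym count ⟩
      Σℕ (λ j → filled (f j))
    ≡⟨ Σ-cong (λ j → sym (nonzero⇒signs (f j) (λ x e → proj₁ (range j x e)))) ⟩
      Σℕ (λ j → positive (f j) + negative (f j))
    ≡⟨ Σ-+ (λ j → positive (f j)) (λ j → negative (f j)) ⟩
      #pos + Σℕ (λ j → negative (f j))
    ≡⟨ cong (λ z → #pos + z) (sym balanced) ⟩
      #pos + #pos
    ∎
    where open ≡-Reasoning

  even : 2 ∣ c
  even = divides #pos (trans c≡#pos+#pos (p+p≡p*2 #pos))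
    where
    p+p≡p*2 : ∀ p → p + p ≡ p * 2
    p+p≡p*2 = solve-∀

  -- With two entries, the positive entry a and the negative entry -b cancel,
  -- so the absolute value a = b occurs twice in the line.
  pair⇒repeat : c ≡ 2 → Σ[ K ∈ ℕ ] (1 ≤ K × K ≤ N × 2 ≤ Σℕ (λ j → hasAbs K (f j)))
  pair⇒repeat c≡2 with Σ-single (λ j → positive (f j)) (λ j → posPart (f j)) #pos≡1
                         (λ j → notPositive⇒posPart≡0 (f j))
                     | Σ-single (λ j → negative (f j)) (λ j → negPart (f j)) #neg≡1
                         (λ j → notNegative⇒negPart≡0 (f j))
    where
    #pos≡1 : #pos ≡ 1
    #pos≡1 = p+p≡2⇒p≡1 #pos (trans (sym c≡#pos+#pos) c≡2)
      where
      p+p≡2⇒p≡1 : ∀ p → p + p ≡ 2 → p ≡ 1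
      p+p≡2⇒p≡1 (suc zero)    _ = refl
      p+p≡2⇒p≡1 (suc (suc p)) e with trans (sym (+-suc (suc p) (suc p))) (suc-injective e)
      ... | ()
    #neg≡1 : Σℕ (λ j → negative (f j)) ≡ 1
    #neg≡1 = trans (sym balanced) #pos≡1
  ... | j₊ , pos₁ , Σpos≡ | j₋ , neg₁ , Σneg≡ =
    K , proj₁ K-inRange , proj₂ K-inRange
      , Σ-two (λ j → hasAbs K (f j)) j₊≢j₋ (≤-reflexive (sym hit₊)) (≤-reflexive (sym hit₋))
    where
    K : ℕ
    K = posPart (f j₊)
    K≡negPart : K ≡ negPart (f j₋)
    K≡negPart = trans (sym Σpos≡) (trans (zeroSum⇒parts≡ f zeroSum) Σneg≡)
    hit₊ : hasAbs K (f j₊) ≡ 1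
    hit₊ = positive⇒hasAbs (f j₊) pos₁
    hit₋ : hasAbs K (f j₋) ≡ 1
    hit₋ = subst (λ z → hasAbs z (f j₋) ≡ 1) (sym K≡negPart) (negative⇒hasAbs (f j₋) neg₁)
    K-inRange : 1 ≤ K × K ≤ N
    K-inRange = hasAbs⇒inRange N K (f j₊) (range j₊) (≤-reflexive (sym hit₊))
    j₊≢j₋ : j₊ ≢ j₋
    j₊≢j₋ refl with trans (sym (positive⇒notNegative (f j₊) pos₁)) neg₁
    ... | ()

  atLeast4 : 1 ≤ c → (∀ K → 1 ≤ K → K ≤ N → Σℕ (λ j → hasAbs K (f j)) ≤ 1) → 4 ≤ c
  atLeast4 1≤c noRepeat with even
  ... | divides zero          c≡0 = ⊥-elim (<-irrefl (sym c≡0) 1≤c)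
  ... | divides (suc (suc q)) refl = s≤s (s≤s (s≤s (s≤s z≤n)))
  ... | divides (suc zero)    c≡2 with pair⇒repeat c≡2
  ...   | K , 1≤K , K≤N , twice = ⊥-elim (<-irrefl refl (≤-trans twice (noRepeat K 1≤K K≤N)))

absSum : ∀ {m n} → Array m n → ℕ
absSum A = Σℕ (λ i → Σℕ (λ j → ∣ val (A i j) ∣))

abs-as-sumTo : ∀ N c → (∀ x → c ≡ just x → 1 ≤ ∣ x ∣ × ∣ x ∣ ≤ N) →
  ∣ val c ∣ ≡ sumTo N (λ k → k * hasAbs k c)
abs-as-sumTo N nothing  _   = sym (sumTo-vanish N (λ k → *-zeroʳ k))
abs-as-sumTo N (just x) rng = sym (sumTo-isValue N ∣ x ∣ (proj₁ (rng x refl)) (proj₂ (rng x refl)))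

halfSet⇒absSum : ∀ {m n} N (A : Array m n) →
  (∀ i j x → A i j ≡ just x → 1 ≤ ∣ x ∣ × ∣ x ∣ ≤ N) →
  (∀ K → 1 ≤ K → K ≤ N → Σℕ (λ i → Σℕ (λ j → hasAbs K (A i j))) ≡ 1) →
  absSum A ≡ sumTo N (λ k → k)
halfSet⇒absSum N A range once = begin
    absSum A
  ≡⟨ Σ-cong (λ i → Σ-cong (λ j → abs-as-sumTo N (A i j) (range i j))) ⟩
    Σℕ (λ i → Σℕ (λ j → sumTo N (λ k → k * hasAbs k (A i j))))
  ≡⟨ Σ-cong (λ i → Σ-sumTo N (λ j k → k * hasAbs k (A i j))) ⟩
    Σℕ (λ i → sumTo N (λ k → Σℕ (λ j → k * hasAbs k (A i j))))
  ≡⟨ Σ-sumTo N (λ i k → Σℕ (λ j → k * hasAbs k (A i j))) ⟩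
    sumTo N (λ k → Σℕ (λ i → Σℕ (λ j → k * hasAbs k (A i j))))
  ≡⟨ sumTo-cong N weight-once ⟩
    sumTo N (λ k → k)
  ∎
  where
  open ≡-Reasoning
  weight-once : ∀ k → 1 ≤ k → k ≤ N → Σℕ (λ i → Σℕ (λ j → k * hasAbs k (A i j))) ≡ k
  weight-once k 1≤k k≤N = begin
      Σℕ (λ i → Σℕ (λ j → k * hasAbs k (A i j)))
    ≡⟨ Σ-cong (λ i → Σ-*ˡ k (λ j → hasAbs k (A i j))) ⟩
      Σℕ (λ i → k * Σℕ (λ j → hasAbs k (A i j)))
    ≡⟨ Σ-*ˡ k (λ i → Σℕ (λ j → hasAbs k (A i j))) ⟩
      k * Σℕ (λ i → Σℕ (λ j → hasAbs k (A i j)))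
    ≡⟨ cong (k *_) (once k 1≤k k≤N) ⟩
      k * 1
    ≡⟨ *-identityʳ k ⟩
      k
    ∎

zeroRows⇒absSum : ∀ {m n} (A : Array m n) → (∀ i → Σℤ (λ j → val (A i j)) ≡ + 0) →
  absSum A ≡ 2 * Σℕ (λ i → Σℕ (λ j → posPart (A i j)))
zeroRows⇒absSum {m} A zeroRow = begin
    absSum A
  ≡⟨ Σ-cong (λ i → sym (Σ-cong (λ j → parts-abs (A i j)))) ⟩
    Σℕ (λ i → Σℕ (λ j → posPart (A i j) + negPart (A i j)))
  ≡⟨ Σ-cong (λ i → Σ-+ (λ j → posPart (A i j)) (λ j → negPart (A i j))) ⟩
    Σℕ (λ i → Pos i + Neg i)
  ≡⟨ Σ-cong (λ i → cong (λ z → Pos i + z) (sym (zeroSum⇒parts≡ (A i) (zeroRow i)))) ⟩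
    Σℕ (λ i → Pos i + Pos i)
  ≡⟨ Σ-cong (λ i → sym (2*p≡p+p (Pos i))) ⟩
    Σℕ (λ i → 2 * Pos i)
  ≡⟨ Σ-*ˡ 2 Pos ⟩
    2 * Σℕ Pos
  ∎
  where
  open ≡-Reasoning
  Pos Neg : Fin m → ℕ
  Pos i = Σℕ (λ j → posPart (A i j))
  Neg i = Σℕ (λ j → negPart (A i j))
  2*p≡p+p : ∀ p → 2 * p ≡ p + p
  2*p≡p+p = solve-∀

lemma6p2 : (m n s t : ℕ) → 1 ≤ m → 1 ≤ n → 1 ≤ s → 1 ≤ t →
    (A : Array m n) → IsHeffter m n s t A → IsShiftable A →
    (2 ∣ s × 4 ≤ s) × (2 ∣ t × 4 ≤ t) × 4 ∣ m * s
lemma6p2 m n s t 1≤m 1≤n 1≤s 1≤t A H S =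
  (Row.even , Row.atLeast4 1≤s rowNoRepeat) , (Col.even , Col.atLeast4 1≤t colNoRepeat) , 4∣N
  where
  open IsHeffter H
  open IsShiftable S
  N : ℕ
  N = m * s
  i₀ : Fin m
  i₀ = fromℕ< 1≤m
  j₀ : Fin n
  j₀ = fromℕ< 1≤n
  module Row = Line N s (A i₀) (entryRange i₀) (rowFilled i₀) (rowBalanced i₀) (rowSum i₀)
  module Col = Line N t (λ i → A i j₀) (λ i → entryRange i j₀) (colFilled j₀)
                 (colBalanced j₀) (colSum j₀)

  -- a single row or column sees each absolute value at most as often as the whole array
  rowNoRepeat : ∀ K → 1 ≤ K → K ≤ N → Σℕ (λ j → hasAbs K (A i₀ j)) ≤ 1
  rowNoRepeat K 1≤K K≤N =
    ≤-trans (Σ-term (λ i → Σℕ (λ j → hasAbs K (A i j))) i₀) (≤-reflexive (halfSet K 1≤K K≤N))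
  colNoRepeat : ∀ K → 1 ≤ K → K ≤ N → Σℕ (λ i → hasAbs K (A i j₀)) ≤ 1
  colNoRepeat K 1≤K K≤N =
    ≤-trans (Σ-mono (λ i → Σ-term (λ j → hasAbs K (A i j)) j₀)) (≤-reflexive (halfSet K 1≤K K≤N))

  P : ℕ
  P = Σℕ (λ i → Σℕ (λ j → posPart (A i j)))
  N[N+1]≡P*4 : N * suc N ≡ P * 4
  N[N+1]≡P*4 = begin
      N * suc N                ≡⟨ sym (gauss N) ⟩
      2 * sumTo N (λ k → k)    ≡⟨ cong (2 *_) (sym (halfSet⇒absSum N A entryRange halfSet)) ⟩
      2 * absSum A             ≡⟨ cong (2 *_) (zeroRows⇒absSum A rowSum) ⟩
      2 * (2 * P)              ≡⟨ 2*[2*p]≡p*4 P ⟩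
      P * 4
    ∎
    where
    open ≡-Reasoning
    2*[2*p]≡p*4 : ∀ p → 2 * (2 * p) ≡ p * 4
    2*[2*p]≡p*4 = solve-∀

  4∣N : 4 ∣ N
  4∣N = 4∣n[n+1]⇒4∣n N (∣n⇒∣m*n m Row.even) (divides P N[N+1]≡P*4)
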